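{- Let $G$ be a $(2,2)$ CCE graph and let $D$ be a minimal digraph of $G$. Then: (i) if a vertex $v$ has exactly one predator (resp. exactly one prey) in $D$, then $v$ has degree $1$ in $G$, and the predator (resp. prey) of $v$ has another prey (resp. predator) which is adjacent to $v$ in $G$; (ii) if a vertex $v$ has two predators (resp. two prey) in $D$, then $v$ has degree $2$ in $G$ or the two predators (resp. the two prey) of $v$ are adjacent in $G$; (iii) any two distinct vertices of $D$ have at most one common prey and at most one common predator.
   Context: All graphs and digraphs are simple (no loops, no multiple arcs). In a digraph $D$, if $(u,x)$ is an arc then $x$ is a prey of $u$ and $u$ is a predator of $x$. The CCE graph $CCE(D)$ of $D$ is the graph on $V(D)$ in which distinct $u,v$ are adjacent iff they have a common prey and a common predator in $D$. A $(2,2)$ digraph is an acyclic digraph in which every vertex has indegree at most $2$ and outdegree at most $2$; a $(2,2)$ CCE graph is the CCE graph of some $(2,2)$ digraph. For a $(2,2)$ CCE graph $G$, a minimal digraph of $G$ is a $(2,2)$ digraph $D$ with $CCE(D)=G$ such that no proper subdigraph $D'$ of $D$ that is a $(2,2)$ digraph satisfies $CCE(D')=G$. -}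

module Defs where

open import Data.Nat using (ℕ; zero; suc; _≤_)
open import Data.Fin using (Fin)
open import Data.Bool using (Bool; true; false; T; if_then_else_)
open import Data.List using (List; map; allFin)
open import Data.Nat.ListAction using (sum)
open import Data.Product using (_×_; Σ; ∃; ∃-syntax; _,_)
open import Data.Empty using (⊥)
open import Relation.Nullary using (¬_)
open import Relation.Binary.PropositionalEquality using (_≡_; _≢_)
open import Function.Bundles using (_⇔_)

-- A digraph on vertex set Fin n: arc relation (u , x) is an arc iff T (D u x).
-- Then x is a prey of u and u is a predator of x.
Digraph : ℕ → Set
Digraph n = Fin n → Fin n → Bool

Graph : ℕ → Set
Graph n = Fin n → Fin n → Bool

Arc : ∀ {n} → Digraph n → Fin n → Fin n → Set
Arc D u x = T (D u x)

countV : ∀ {n} → (Fin n → Bool) → ℕ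
countV {n} p = sum (map (λ u → if p u then 1 else 0) (allFin n))

indeg : ∀ {n} → Digraph n → Fin n → ℕ
indeg D v = countV (λ u → D u v)

outdeg : ∀ {n} → Digraph n → Fin n → ℕ
outdeg D v = countV (λ x → D v x)

degree : ∀ {n} → Graph n → Fin n → ℕ
degree G v = countV (λ u → G v u)

data Reach {n} (D : Digraph n) : Fin n → Fin n → Set where
  step : ∀ {u v} → Arc D u v → Reach D u v
  cons : ∀ {u w v} → Arc D u w → Reach D w v → Reach D u v

Simple : ∀ {n} → Digraph n → Set
Simple {n} D = (u : Fin n) → ¬ Arc D u u

Acyclic : ∀ {n} → Digraph n → Set
Acyclic {n} D = (u : Fin n) → ¬ Reach D u u

Is22 : ∀ {n} → Digraph n → Set
Is22 {n} D = Simple D × Acyclic D ×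
  ((v : Fin n) → indeg D v ≤ 2) × ((v : Fin n) → outdeg D v ≤ 2)

CCEAdj : ∀ {n} → Digraph n → Fin n → Fin n → Set
CCEAdj {n} D u v = u ≢ v
  × (∃[ x ] (Arc D u x × Arc D v x))
  × (∃[ w ] (Arc D w u × Arc D w v))

IsCCE : ∀ {n} → Digraph n → Graph n → Set
IsCCE {n} D G = (u v : Fin n) → T (G u v) ⇔ CCEAdj D u v

-- D' is a proper spanning subdigraph of D (a subdigraph with fewer vertices
-- has a CCE graph on a different vertex set, hence cannot equal G)
ProperSub : ∀ {n} → Digraph n → Digraph n → Set
ProperSub {n} D' D = ((u v : Fin n) → Arc D' u v → Arc D u v)
  × (∃[ u ] ∃[ v ] (Arc D u v × ¬ Arc D' u v))

MinimalDigraph : ∀ {n} → Graph n → Digraph n → Set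
MinimalDigraph {n} G D = Is22 D × IsCCE D G
  × ((D' : Digraph n) → ProperSub D' D → Is22 D' → ¬ IsCCE D' G)

Is22CCE : ∀ {n} → Graph n → Set
Is22CCE {n} G = ∃[ D ] (Is22 D × IsCCE D G)

module Submission where

-- Every part is proved by deleting one arc p → q of the minimal digraph D. The result is still
-- a (2,2) digraph, so by minimality some adjacency of G must lose its only common prey q or its
-- only common predator p; the bounds indegree, outdegree ≤ 2 then force the configuration claimed,
-- since otherwise a replacement prey or predator survives the deletion. The statements about prey
-- are those about predators for the converse digraph, which is again a minimal digraph of G.

open import Defs
open import Data.Nat using (ℕ; zero; suc; _≤_; _<_; _+_; z≤n; s≤s; s≤s⁻¹)
open import Data.Nat.Properties using (≤-refl; ≤-trans; ≤-reflexive; +-mono-≤; +-suc; ≤⇒≯; ≮⇒≥; n≤0⇒n≡0)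
open import Data.Fin using (Fin; zero; suc)
open import Data.Fin.Properties using (_≟_; any?)
open import Data.Bool using (Bool; true; false; T; if_then_else_; _∧_; not)
open import Data.Bool.Properties using (∧-identityʳ; T-∧)
open import Data.List.Properties using (map-tabulate)
open import Data.Nat.ListAction using (sum)
open import Data.Product using (_×_; ∃-syntax; ∃₂; _,_; proj₁; proj₂)
open import Data.Sum using (_⊎_; inj₁; inj₂; [_,_]′)
open import Data.Empty using (⊥; ⊥-elim)
open import Relation.Nullary using (¬_; yes; no; does; contradiction)
open import Relation.Nullary.Decidable using (T?; ¬?; _×-dec_; decidable-stable)
open import Relation.Binary.PropositionalEquality
open import Relation.Binary.Definitions using (Symmetric)
open import Function using (_∘_; id)
open import Function.Bundles using (Equivalence; mk⇔; _⇔_)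
open Equivalence using (to; from)

indicator : Bool → ℕ
indicator b = if b then 1 else 0

_without_ : ∀ {n} → (Fin n → Bool) → Fin n → Fin n → Bool
(p without a) x = p x ∧ not (does (x ≟ a))

module _ {n : ℕ} (p : Fin n → Bool) where

  without-⊆ : ∀ {a x} → T ((p without a) x) → T (p x)
  without-⊆ = proj₁ ∘ to T-∧

  without-≢ : ∀ {a x} → T ((p without a) x) → x ≢ a
  without-≢ {a} {x} t with x ≟ a
  ... | yes _   = λ _ → proj₂ (to T-∧ t)
  ... | no  x≢a = x≢a

  without-intro : ∀ {a x} → T (p x) → x ≢ a → T ((p without a) x)
  without-intro {a} {x} t x≢a with x ≟ a
  ... | yes x≡a = ⊥-elim (x≢a x≡a)
  ... | no _ = from T-∧ (t , _)

countV-suc : ∀ {n} (p : Fin (suc n) → Bool) → countV p ≡ indicator (p zero) + countV (p ∘ suc)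
countV-suc p = cong (indicator (p zero) +_) (trans
  (cong sum (map-tabulate suc (indicator ∘ p)))
  (sym (cong sum (map-tabulate id (indicator ∘ p ∘ suc)))))

countV-cong : ∀ {n} {p q : Fin n → Bool} → (∀ x → p x ≡ q x) → countV p ≡ countV q
countV-cong {zero} e = refl
countV-cong {suc n} {p} {q} e = begin
  countV p                                   ≡⟨ countV-suc p ⟩
  indicator (p zero) + countV (p ∘ suc)      ≡⟨ cong₂ _+_ (cong indicator (e zero)) (countV-cong (e ∘ suc)) ⟩
  indicator (q zero) + countV (q ∘ suc)      ≡⟨ sym (countV-suc q) ⟩
  countV q                                   ∎
  where open ≡-Reasoning

countV-mono : ∀ {n} {p q : Fin n → Bool} → (∀ x → T (p x) → T (q x)) → countV p ≤ countV q
countV-mono {zero} f = z≤n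
countV-mono {suc n} {p} {q} f rewrite countV-suc p | countV-suc q =
  +-mono-≤ (indicator-mono (f zero)) (countV-mono (f ∘ suc))
  where
  indicator-mono : ∀ {a b} → (T a → T b) → indicator a ≤ indicator b
  indicator-mono {false} _ = z≤n
  indicator-mono {true} {true} _ = ≤-refl
  indicator-mono {true} {false} f = ⊥-elim (f _)

countV-witness : ∀ {n} (p : Fin n → Bool) → 0 < countV p → ∃[ x ] T (p x)
countV-witness {zero} p ()
countV-witness {suc n} p pos with p zero in eq | subst (0 <_) (countV-suc p) pos
... | true  | _ = zero , subst T (sym eq) _
... | false | pos′ with countV-witness (p ∘ suc) pos′
...   | x , px = suc x , px

countV-remove : ∀ {n} (p : Fin n → Bool) {a} → T (p a) → countV p ≡ suc (countV (p without a))
countV-remove {suc n} p {zero} pa with p zero | countV-suc p | countV-suc (p without zero)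
... | true | eq | eq′ = trans eq (cong suc (trans
  (countV-cong (λ x → sym (∧-identityʳ (p (suc x))))) (sym eq′)))
countV-remove {suc n} p {suc a} pa = begin
  countV p
    ≡⟨ countV-suc p ⟩
  indicator (p zero) + countV (p ∘ suc)
    ≡⟨ cong (indicator (p zero) +_) (countV-remove (p ∘ suc) pa) ⟩
  indicator (p zero) + suc (countV ((p ∘ suc) without a))
    ≡⟨ +-suc (indicator (p zero)) _ ⟩
  suc (indicator (p zero) + countV ((p ∘ suc) without a))
    ≡⟨ cong (λ b → suc (indicator b + countV ((p ∘ suc) without a))) (sym (∧-identityʳ (p zero))) ⟩
  suc (indicator ((p without suc a) zero) + countV ((p without suc a) ∘ suc))
    ≡⟨ cong suc (sym (countV-suc (p without suc a))) ⟩
  suc (countV (p without suc a))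
    ∎
  where open ≡-Reasoning

module _ {n : ℕ} (p : Fin n → Bool) where

  countV-pos : ∀ {a} → T (p a) → 0 < countV p
  countV-pos pa rewrite countV-remove p pa = s≤s z≤n

  countV-none : (∀ x → ¬ T (p x)) → countV p ≡ 0
  countV-none none = n≤0⇒n≡0 (≮⇒≥ λ pos → let x , px = countV-witness p pos in none x px)

countV-≥2 : ∀ {n} (p : Fin n → Bool) {a b} → a ≢ b → T (p a) → T (p b) → 2 ≤ countV p
countV-≥2 p a≢b pa pb rewrite countV-remove p pa =
  s≤s (countV-pos (p without _) (without-intro p pb (a≢b ∘ sym)))

countV-≥3 : ∀ {n} (p : Fin n → Bool) {a b c} → a ≢ b → c ≢ a → c ≢ b →
            T (p a) → T (p b) → T (p c) → 3 ≤ countV p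
countV-≥3 p a≢b c≢a c≢b pa pb pc rewrite countV-remove p pa =
  s≤s (countV-≥2 (p without _) c≢b (without-intro p pc c≢a) (without-intro p pb (a≢b ∘ sym)))

countV-one : ∀ {n} (p : Fin n → Bool) {a} → T (p a) → (∀ x → T (p x) → x ≡ a) → countV p ≡ 1
countV-one p pa only-a = trans (countV-remove p pa) (cong suc (countV-none (p without _)
  λ x px′ → without-≢ p px′ (only-a x (without-⊆ p px′))))

countV-two : ∀ {n} (p : Fin n → Bool) {a b} → a ≢ b → T (p a) → T (p b) →
             (∀ x → T (p x) → x ≡ a ⊎ x ≡ b) → countV p ≡ 2
countV-two p {a} {b} a≢b pa pb only-ab = trans (countV-remove p pa) (cong suc
  (countV-one (p without a) (without-intro p pb (a≢b ∘ sym))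
    λ x px′ → ≡b (only-ab x (without-⊆ p px′)) (without-≢ p px′)))
  where
  ≡b : ∀ {x} → x ≡ a ⊎ x ≡ b → x ≢ a → x ≡ b
  ≡b (inj₁ x≡a) x≢a = contradiction x≡a x≢a
  ≡b (inj₂ x≡b) _   = x≡b

module _ {n : ℕ} (p : Fin n → Bool) where

  countV≤1⇒≡ : countV p ≤ 1 → ∀ {a b} → T (p a) → T (p b) → b ≡ a
  countV≤1⇒≡ ≤1 {a} {b} pa pb with b ≟ a
  ... | yes b≡a = b≡a
  ... | no  b≢a = contradiction (countV-≥2 p b≢a pb pa) (≤⇒≯ ≤1)

  countV≤2⇒≡⊎≡ : countV p ≤ 2 → ∀ {a b c} → a ≢ b → T (p a) → T (p b) → T (p c) → c ≡ a ⊎ c ≡ b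
  countV≤2⇒≡⊎≡ ≤2 {a} {b} {c} a≢b pa pb pc with c ≟ a | c ≟ b
  ... | yes c≡a | _       = inj₁ c≡a
  ... | no  _   | yes c≡b = inj₂ c≡b
  ... | no  c≢a | no  c≢b = contradiction (countV-≥3 p a≢b c≢a c≢b pa pb pc) (≤⇒≯ ≤2)

  countV≡2⇒pair : countV p ≡ 2 → ∃₂ λ a b → a ≢ b × T (p a) × T (p b)
  countV≡2⇒pair eq with countV-witness p (subst (0 <_) (sym eq) (s≤s z≤n))
  ... | a , pa
    with countV-witness (p without a) (s≤s⁻¹ (subst (2 ≤_) (trans (sym eq) (countV-remove p pa)) ≤-refl))
  ...   | b , pb′ = a , b , without-≢ p pb′ ∘ sym , pa , without-⊆ p pb′

sym-pair-⇔ : ∀ {a ℓ} {A : Set a} {R : A → A → Set ℓ} → Symmetric R →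
             ∀ {a b u w} → a ≢ b → a ≡ u ⊎ a ≡ w → b ≡ u ⊎ b ≡ w → R a b ⇔ R u w
sym-pair-⇔ R-sym a≢b (inj₁ refl) (inj₁ refl) = contradiction refl a≢b
sym-pair-⇔ R-sym a≢b (inj₁ refl) (inj₂ refl) = mk⇔ id id
sym-pair-⇔ R-sym a≢b (inj₂ refl) (inj₁ refl) = mk⇔ R-sym R-sym
sym-pair-⇔ R-sym a≢b (inj₂ refl) (inj₂ refl) = contradiction refl a≢b

module _ {n : ℕ} where

  _⊆_ : Digraph n → Digraph n → Set
  D′ ⊆ D = ∀ u v → Arc D′ u v → Arc D u v

  CommonPrey CommonPred : Digraph n → Fin n → Fin n → Set
  CommonPrey D a b = ∃[ x ] (Arc D a x × Arc D b x)
  CommonPred D a b = ∃[ w ] (Arc D w a × Arc D w b)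

  Reach-mono : ∀ {D′ D : Digraph n} → D′ ⊆ D → ∀ {u v} → Reach D′ u v → Reach D u v
  Reach-mono D′⊆D (step uv)    = step (D′⊆D _ _ uv)
  Reach-mono D′⊆D (cons uw wv) = cons (D′⊆D _ _ uw) (Reach-mono D′⊆D wv)

  Is22-mono : ∀ {D′ D : Digraph n} → D′ ⊆ D → Is22 D → Is22 D′
  Is22-mono D′⊆D (simple , acyclic , indeg≤2 , outdeg≤2) =
    (λ u → simple u ∘ D′⊆D u u) ,
    (λ u → acyclic u ∘ Reach-mono D′⊆D) ,
    (λ v → ≤-trans (countV-mono (λ u → D′⊆D u v)) (indeg≤2 v)) ,
    (λ v → ≤-trans (countV-mono (D′⊆D v)) (outdeg≤2 v))

  CCEAdj-mono : ∀ {D′ D : Digraph n} → D′ ⊆ D → ∀ {a b} → CCEAdj D′ a b → CCEAdj D a b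
  CCEAdj-mono D′⊆D (a≢b , (x , ax , bx) , (w , wa , wb)) =
    a≢b , (x , D′⊆D _ _ ax , D′⊆D _ _ bx) , (w , D′⊆D _ _ wa , D′⊆D _ _ wb)

  CCEAdj-sym : ∀ {D : Digraph n} → Symmetric (CCEAdj D)
  CCEAdj-sym (a≢b , (x , ax , bx) , (w , wa , wb)) = a≢b ∘ sym , (x , bx , ax) , (w , wb , wa)

  G-sym : ∀ {D : Digraph n} {G : Graph n} → IsCCE D G → Symmetric (λ a b → T (G a b))
  G-sym cce {a} {b} = from (cce b a) ∘ CCEAdj-sym ∘ to (cce a b)

  converse : Digraph n → Digraph n
  converse D u v = D v u

  Reach-snoc : ∀ {D : Digraph n} {u v w} → Reach D u v → Arc D v w → Reach D u w
  Reach-snoc (step uv)    vw = cons uv (step vw)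
  Reach-snoc (cons uu′ r) vw = cons uu′ (Reach-snoc r vw)

  Reach-converse : ∀ {D : Digraph n} {u v} → Reach (converse D) u v → Reach D v u
  Reach-converse (step uv)    = step uv
  Reach-converse {D} (cons uw wv) = Reach-snoc {D} (Reach-converse wv) uw

  Is22-converse : ∀ {D : Digraph n} → Is22 D → Is22 (converse D)
  Is22-converse {D} (simple , acyclic , indeg≤2 , outdeg≤2) =
    simple , (λ u → acyclic u ∘ Reach-converse {D}) , outdeg≤2 , indeg≤2

  CCEAdj-converse : ∀ {D : Digraph n} {a b} → CCEAdj D a b → CCEAdj (converse D) a b
  CCEAdj-converse (a≢b , prey , pred) = a≢b , pred , prey

  IsCCE-converse : ∀ {D : Digraph n} {G : Graph n} → IsCCE D G → IsCCE (converse D) G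
  IsCCE-converse {D} cce a b =
    mk⇔ (CCEAdj-converse {D} ∘ to (cce a b)) (from (cce a b) ∘ CCEAdj-converse {converse D})

  MinimalDigraph-converse : ∀ {G : Graph n} {D : Digraph n} →
                            MinimalDigraph G D → MinimalDigraph G (converse D)
  MinimalDigraph-converse {G} {D} (is22 , cce , minimal) =
    Is22-converse {D} is22 , IsCCE-converse {D} cce ,
    λ { D′ (D′⊆ , u , v , uv , ¬uv′) is22′ cce′ →
        minimal (converse D′) ((λ a b → D′⊆ b a) , v , u , uv , ¬uv′)
                (Is22-converse {D′} is22′) (IsCCE-converse {D′} cce′) }

  removeArc : Digraph n → Fin n → Fin n → Digraph n
  removeArc D p q a b = D a b ∧ not (does (a ≟ p) ∧ does (b ≟ q))

  module _ {D : Digraph n} {p q : Fin n} where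

    removeArc-⊆ : removeArc D p q ⊆ D
    removeArc-⊆ _ _ = proj₁ ∘ to T-∧

    removeArc-removes : ¬ Arc (removeArc D p q) p q
    removeArc-removes pq with p ≟ p | q ≟ q
    ... | yes _  | yes _  = proj₂ (to T-∧ pq)
    ... | no p≢p | _      = p≢p refl
    ... | yes _  | no q≢q = q≢q refl

    removeArc-keeps : ∀ {a b} → Arc D a b → a ≢ p ⊎ b ≢ q → Arc (removeArc D p q) a b
    removeArc-keeps {a} {b} ab other with a ≟ p | b ≟ q
    ... | no _    | _       = from T-∧ (ab , _)
    ... | yes _   | no _    = from T-∧ (ab , _)
    ... | yes a≡p | yes b≡q = [ contradiction a≡p , contradiction b≡q ]′ other

    -- Removing p → q can only destroy a common prey q or a common predator p; a repair replaces it.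
    PreyRepair PredRepair : Set
    PreyRepair = ∀ {a b} → CCEAdj D a b → Arc D a q → Arc D b q → CommonPrey (removeArc D p q) a b
    PredRepair = ∀ {a b} → CCEAdj D a b → Arc D p a → Arc D p b → CommonPred (removeArc D p q) a b

    removeArc-preserves-CCEAdj : PreyRepair → PredRepair →
                                 ∀ {a b} → CCEAdj D a b → CCEAdj (removeArc D p q) a b
    removeArc-preserves-CCEAdj prey-repair pred-repair adj@(a≢b , (x , ax , bx) , (w , wa , wb)) =
      a≢b , prey , pred
      where
      prey : CommonPrey (removeArc D p q) _ _
      prey with x ≟ q
      ... | yes refl = prey-repair adj ax bx
      ... | no x≢q   = x , removeArc-keeps ax (inj₂ x≢q) , removeArc-keeps bx (inj₂ x≢q)
      pred : CommonPred (removeArc D p q) _ _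
      pred with w ≟ p
      ... | yes refl = pred-repair adj wa wb
      ... | no w≢p   = w , removeArc-keeps wa (inj₁ w≢p) , removeArc-keeps wb (inj₁ w≢p)

    MinimalDigraph⇒arc-essential : ∀ {G : Graph n} → MinimalDigraph G D → Arc D p q →
                                   PreyRepair → PredRepair → ⊥
    MinimalDigraph⇒arc-essential (is22 , cce , minimal) pq prey-repair pred-repair =
      minimal (removeArc D p q) (removeArc-⊆ , p , q , pq , removeArc-removes)
              (Is22-mono removeArc-⊆ is22)
              λ a b → mk⇔ (removeArc-preserves-CCEAdj prey-repair pred-repair ∘ to (cce a b))
                          (from (cce a b) ∘ CCEAdj-mono removeArc-⊆)

module DegreeBounds {n : ℕ} {D : Digraph n} where

  predators-≤2 : ∀ {v} → indeg D v ≤ 2 → ∀ {u w a} → u ≢ w →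
                 Arc D u v → Arc D w v → Arc D a v → a ≡ u ⊎ a ≡ w
  predators-≤2 {v} = countV≤2⇒≡⊎≡ (λ u → D u v)

  prey-≤2 : ∀ {u} → outdeg D u ≤ 2 → ∀ {x y z} → x ≢ y →
            Arc D u x → Arc D u y → Arc D u z → z ≡ x ⊎ z ≡ y
  prey-≤2 {u} = countV≤2⇒≡⊎≡ (D u)

  prey-other-than : ∀ {u} → outdeg D u ≤ 2 → ∀ {v x z} →
                    Arc D u v → Arc D u x → x ≢ v → Arc D u z → z ≢ v → z ≡ x
  prey-other-than ≤2 uv ux x≢v uz z≢v =
    [ (λ z≡v → contradiction z≡v z≢v) , id ]′ (prey-≤2 ≤2 (x≢v ∘ sym) uv ux uz)

  predators-shared : ∀ {x} → indeg D x ≤ 2 → ∀ {u v y a} → u ≢ v →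
                     Arc D u x → Arc D v x → Arc D u y → Arc D v y → Arc D a x → Arc D a y
  predators-shared ≤2 u≢v ux vx uy vy ax with predators-≤2 ≤2 u≢v ux vx ax
  ... | inj₁ refl = uy
  ... | inj₂ refl = vy

module Minimal {n : ℕ} {G : Graph n} {D : Digraph n} (minimal : MinimalDigraph G D) where

  open DegreeBounds {D = D}

  private
    cce : IsCCE D G
    cce = proj₁ (proj₂ minimal)

    indeg≤2 : ∀ v → indeg D v ≤ 2
    indeg≤2 = proj₁ (proj₂ (proj₂ (proj₁ minimal)))

    outdeg≤2 : ∀ v → outdeg D v ≤ 2
    outdeg≤2 = proj₂ (proj₂ (proj₂ (proj₁ minimal)))

    adj⇒G : ∀ {a b} → CCEAdj D a b → T (G a b)
    adj⇒G = from (cce _ _)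

    G⇒adj : ∀ {a b} → T (G a b) → CCEAdj D a b
    G⇒adj = to (cce _ _)

    arc-essential : ∀ {p q} → Arc D p q → PreyRepair {D = D} {p} {q} → PredRepair {D = D} {p} {q} → ⊥
    arc-essential = MinimalDigraph⇒arc-essential minimal

    keep : ∀ {p q a b} → Arc D a b → a ≢ p ⊎ b ≢ q → Arc (removeArc D p q) a b
    keep = removeArc-keeps {D = D}

  sole-predator : ∀ {u v} → Arc D u v → (∀ a → Arc D a v → a ≡ u) →
                  degree G v ≡ 1 × ∃[ x ] (x ≢ v × Arc D u x × T (G v x))
  sole-predator {u} {v} uv only-u = degree≡1 , x , x≢v , ux , gx
    where
    neighbour : ∃[ x ] T (G v x)
    neighbour with any? (λ x → T? (G v x))
    ... | yes nb  = nb
    ... | no  ¬nb = ⊥-elim (arc-essential uv prey-repair pred-repair)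
      where
      prey-repair : PreyRepair
      prey-repair (a≢b , _) av bv = contradiction (trans (only-u _ av) (sym (only-u _ bv))) a≢b
      pred-repair : PredRepair
      pred-repair {a} {b} adj ua ub with a ≟ v | b ≟ v
      ... | yes refl | _        = ⊥-elim (¬nb (b , adj⇒G adj))
      ... | no  _    | yes refl = ⊥-elim (¬nb (a , adj⇒G (CCEAdj-sym {D = D} adj)))
      ... | no  a≢v  | no  b≢v  = u , keep ua (inj₂ a≢v) , keep ub (inj₂ b≢v)

    -- A neighbour of v shares a predator with v, which can only be u.
    preyed-by-u : ∀ {y} → T (G v y) → y ≢ v × Arc D u y
    preyed-by-u gy with G⇒adj gy
    ... | v≢y , _ , (w , wv , wy) = v≢y ∘ sym , subst (λ w → Arc D w _) (only-u w wv) wy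

    x : Fin n
    x = proj₁ neighbour

    gx : T (G v x)
    gx = proj₂ neighbour

    x≢v : x ≢ v
    x≢v = proj₁ (preyed-by-u gx)

    ux : Arc D u x
    ux = proj₂ (preyed-by-u gx)

    degree≡1 : degree G v ≡ 1
    degree≡1 = countV-one (G v) gx λ y gy →
      let y≢v , uy = preyed-by-u gy in prey-other-than (outdeg≤2 u) uv ux x≢v uy y≢v

  one-predator : ∀ {v} → indeg D v ≡ 1 →
                 degree G v ≡ 1 × (∀ u → Arc D u v → ∃[ x ] (x ≢ v × Arc D u x × T (G v x)))
  one-predator {v} indeg≡1 with countV-witness (λ u → D u v) (subst (0 <_) (sym indeg≡1) (s≤s z≤n))
  ... | u , uv = proj₁ sole , λ u′ u′v → subst (λ u → ∃[ x ] (x ≢ v × Arc D u x × T (G v x)))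
                                                (sym (only-u u′ u′v)) (proj₂ sole)
    where
    only-u : ∀ a → Arc D a v → a ≡ u
    only-u a av = countV≤1⇒≡ (λ u → D u v) (≤-reflexive indeg≡1) uv av
    sole : degree G v ≡ 1 × ∃[ x ] (x ≢ v × Arc D u x × T (G v x))
    sole = sole-predator uv only-u

  -- Since u → v is essential and u, w are not adjacent, its removal must cut v off from a
  -- neighbour that v sees only through u.
  private-neighbour : ∀ {u w v} → Arc D u v → Arc D w v → u ≢ w → ¬ T (G u w) →
                      ∃[ y ] (y ≢ v × Arc D u y × ¬ Arc D w y × T (G v y))
  private-neighbour {u} {w} {v} uv wv u≢w ¬guw
    with any? (λ y → ¬? (y ≟ v) ×-dec T? (D u y) ×-dec ¬? (T? (D w y)) ×-dec T? (G v y))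
  ... | yes found = found
  ... | no ¬found = ⊥-elim (arc-essential uv prey-repair pred-repair)
    where
    w≢u : w ≢ u
    w≢u = u≢w ∘ sym

    predator-of-v : ∀ {a} → Arc D a v → a ≡ u ⊎ a ≡ w
    predator-of-v = predators-≤2 (indeg≤2 v) u≢w uv wv

    prey-repair : PreyRepair
    prey-repair adj@(a≢b , _) av bv = contradiction
      (adj⇒G (to (sym-pair-⇔ (CCEAdj-sym {D = D}) a≢b (predator-of-v av) (predator-of-v bv)) adj)) ¬guw

    via-w : ∀ {b} → b ≢ v → Arc D u b → T (G v b) → Arc D w b
    via-w b≢v ub gb = decidable-stable (T? (D w _)) λ ¬wb → ¬found (_ , b≢v , ub , ¬wb , gb)

    pred-repair : PredRepair
    pred-repair {a} {b} adj ua ub with a ≟ v | b ≟ v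
    ... | yes refl | _        =
      w , keep wv (inj₁ w≢u) , keep (via-w (proj₁ adj ∘ sym) ub (adj⇒G adj)) (inj₁ w≢u)
    ... | no  _    | yes refl =
      w , keep (via-w (proj₁ adj) ua (adj⇒G (CCEAdj-sym {D = D} adj))) (inj₁ w≢u) , keep wv (inj₁ w≢u)
    ... | no  a≢v  | no  b≢v  = u , keep ua (inj₂ a≢v) , keep ub (inj₂ b≢v)

  predator-pair : ∀ {u w v} → Arc D u v → Arc D w v → u ≢ w → degree G v ≡ 2 ⊎ T (G u w)
  predator-pair {u} {w} {v} uv wv u≢w with T? (G u w)
  ... | yes guw = inj₂ guw
  ... | no ¬guw
    with private-neighbour uv wv u≢w ¬guw | private-neighbour wv uv (u≢w ∘ sym) (¬guw ∘ G-sym cce)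
  ... | y , y≢v , uy , ¬wy , gy | y′ , y′≢v , wy′ , _ , gy′ =
    inj₁ (countV-two (G v) (λ y≡y′ → ¬wy (subst (Arc D w) (sym y≡y′) wy′)) gy gy′ neighbours)
    where
    neighbours : ∀ z → T (G v z) → z ≡ y ⊎ z ≡ y′
    neighbours z gz with G⇒adj gz
    ... | v≢z , _ , (k , kv , kz) with predators-≤2 (indeg≤2 v) u≢w uv wv kv
    ...   | inj₁ refl = inj₁ (prey-other-than (outdeg≤2 u) uv uy y≢v kz (v≢z ∘ sym))
    ...   | inj₂ refl = inj₂ (prey-other-than (outdeg≤2 w) wv wy′ y′≢v kz (v≢z ∘ sym))

  two-predators : ∀ {v} → indeg D v ≡ 2 →
                  degree G v ≡ 2 ⊎ (∀ a b → a ≢ b → Arc D a v → Arc D b v → T (G a b))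
  two-predators {v} indeg≡2 with countV≡2⇒pair (λ u → D u v) indeg≡2
  ... | u , w , u≢w , uv , wv with predator-pair uv wv u≢w
  ...   | inj₁ degree≡2 = inj₁ degree≡2
  ...   | inj₂ guw      = inj₂ λ a b a≢b av bv →
    from (sym-pair-⇔ (G-sym cce) a≢b (predator-of-v av) (predator-of-v bv)) guw
    where
    predator-of-v : ∀ {a} → Arc D a v → a ≡ u ⊎ a ≡ w
    predator-of-v = predators-≤2 (indeg≤2 v) u≢w uv wv

  common-prey-unique : ∀ {u v} → u ≢ v → ∀ {x y} →
                       Arc D u x → Arc D v x → Arc D u y → Arc D v y → x ≡ y
  common-prey-unique {u} {v} u≢v {x} {y} ux vx uy vy with x ≟ y
  ... | yes x≡y = x≡y
  ... | no  x≢y = ⊥-elim (arc-essential ux prey-repair pred-repair)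
    where
    predator-of-x⇒of-y : ∀ {a} → Arc D a x → Arc D a y
    predator-of-x⇒of-y = predators-shared (indeg≤2 x) u≢v ux vx uy vy

    prey-of-u⇒of-v : ∀ {a} → Arc D u a → Arc D v a
    prey-of-u⇒of-v = DegreeBounds.predators-shared {D = converse D} (outdeg≤2 u) x≢y ux uy vx vy

    prey-repair : PreyRepair
    prey-repair _ ax bx = y , keep (predator-of-x⇒of-y ax) (inj₂ (x≢y ∘ sym))
                            , keep (predator-of-x⇒of-y bx) (inj₂ (x≢y ∘ sym))
    pred-repair : PredRepair
    pred-repair _ ua ub = v , keep (prey-of-u⇒of-v ua) (inj₁ (u≢v ∘ sym))
                            , keep (prey-of-u⇒of-v ub) (inj₁ (u≢v ∘ sym))

proposition4p3 : (n : ℕ) (G : Graph n) (D : Digraph n) →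
    Is22CCE G → MinimalDigraph G D →
    ((v : Fin n) → indeg D v ≡ 1 →
      (degree G v ≡ 1) ×
      ((u : Fin n) → Arc D u v → ∃[ x ] (x ≢ v × Arc D u x × T (G v x))))
    × ((v : Fin n) → outdeg D v ≡ 1 →
      (degree G v ≡ 1) ×
      ((x : Fin n) → Arc D v x → ∃[ w ] (w ≢ v × Arc D w x × T (G v w))))
    × ((v : Fin n) → indeg D v ≡ 2 →
      (degree G v ≡ 2) ⊎
      ((u w : Fin n) → u ≢ w → Arc D u v → Arc D w v → T (G u w)))
    × ((v : Fin n) → outdeg D v ≡ 2 →
      (degree G v ≡ 2) ⊎
      ((x y : Fin n) → x ≢ y → Arc D v x → Arc D v y → T (G x y)))
    × ((u v : Fin n) → u ≢ v →
      ((x y : Fin n) → Arc D u x → Arc D v x → Arc D u y → Arc D v y → x ≡ y)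
      × ((w z : Fin n) → Arc D w u → Arc D w v → Arc D z u → Arc D z v → w ≡ z))
proposition4p3 n G D _ minimal =
  (λ v → M.one-predator) , (λ v → Mᶜ.one-predator) ,
  (λ v → M.two-predators) , (λ v → Mᶜ.two-predators) ,
  λ u v u≢v → (λ x y → M.common-prey-unique u≢v) , (λ w z → Mᶜ.common-prey-unique u≢v)
  where
  module M  = Minimal minimal
  module Mᶜ = Minimal (MinimalDigraph-converse minimal)
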